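{- Let $(M,\cdot,e)$ be a partial commutative monoid and $\mathrm{cl}$ a strong closure operator on $\mathcal P(M)$, and let $\mathcal C$ be the set of closed sets. Then $(\mathcal C,*,\mathsf{emp})$, where $X*Y=\mathrm{cl}(X\bullet Y)$ and $\mathsf{emp}=\mathrm{cl}(\{e\})$, is a commutative monoid.
   Context: A partial commutative monoid $(M,\cdot,e)$ has a partially defined commutative, associative composition with unit $e$. For $X,Y\subseteq M$: $X\bullet Y=\{x\cdot y\mid x\in X,y\in Y, x\cdot y\text{ defined}\}$. A closure operator on $\mathcal P(M)$ is a map $\mathrm{cl}$ that is extensive ($X\subseteq\mathrm{cl}(X)$), monotone and idempotent; $X$ is closed if $\mathrm{cl}(X)=X$. It is strong if $\mathrm{cl}(X)\bullet Y\subseteq\mathrm{cl}(X\bullet Y)$ for all $X,Y\subseteq M$. -}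

module Defs where

open import Level using (Level; suc)
open import Data.Maybe using (Maybe; just; _>>=_)
open import Data.Product using (Σ; ∃; ∃-syntax; _×_; _,_; proj₁; proj₂)
open import Relation.Binary.PropositionalEquality using (_≡_)
open import Relation.Unary using (Pred; _⊆_; _≐_; _∈_)
open import Algebra.Structures using (IsCommutativeMonoid)

-- A partial commutative monoid: the composition is a partial function,
-- modelled as  _·_ : M → M → Maybe M  (nothing = undefined).
-- Commutativity and associativity are Kleene equalities (both sides
-- undefined, or both defined and equal); e is a unit (e·x always defined = x).
record PCM (a : Level) : Set (suc a) where
  field
    Carrier  : Set a
    _·_      : Carrier → Carrier → Maybe Carrier
    e        : Carrier
    comm     : ∀ x y → x · y ≡ y · x
    assoc    : ∀ x y z → ((x · y) >>= λ w → w · z) ≡ ((y · z) >>= λ w → x · w)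
    identity : ∀ x → e · x ≡ just x

module _ {a : Level} (M : PCM a) where
  open PCM M

  _•_ : Pred Carrier a → Pred Carrier a → Pred Carrier a
  (X • Y) z = ∃[ x ] ∃[ y ] (x ∈ X × y ∈ Y × x · y ≡ just z)

  ｛e｝ : Pred Carrier a
  ｛e｝ z = z ≡ e

  record ClosureOperator : Set (suc a) where
    field
      cl         : Pred Carrier a → Pred Carrier a
      extensive  : ∀ X → X ⊆ cl X
      monotone   : ∀ {X Y} → X ⊆ Y → cl X ⊆ cl Y
      idempotent : ∀ X → cl (cl X) ≐ cl X

  module _ (C : ClosureOperator) where
    open ClosureOperator C

    IsStrong : Set (suc a)
    IsStrong = ∀ X Y → (cl X • Y) ⊆ cl (X • Y)

    IsClosed : Pred Carrier a → Set a
    IsClosed X = cl X ≐ X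

    Closed : Set (suc a)
    Closed = Σ (Pred Carrier a) IsClosed

    _≈𝒞_ : Closed → Closed → Set a
    X ≈𝒞 Y = proj₁ X ≐ proj₁ Y

    clIsClosed : ∀ X → IsClosed (cl X)
    clIsClosed X = idempotent X

    _*_ : Closed → Closed → Closed
    X * Y = cl (proj₁ X • proj₁ Y) , clIsClosed _

    emp : Closed
    emp = cl ｛e｝ , clIsClosed _

-- Strength lets cl be pulled out of either factor, cl (cl X • Y) = cl (X • Y), so every
-- law of * reduces, after one application of cl, to the corresponding law of the
-- lifted product • on subsets, which inherits it from the partial monoid.
module Submission where

open import Defs
open import Level using (Level)
open import Algebra.Structures using (IsCommutativeMonoid)
open import Algebra.Structures.Biased using (isCommutativeMonoidˡ)
open import Data.Maybe using (Maybe; just; nothing; _>>=_)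
open import Data.Maybe.Properties using (just-injective)
open import Data.Product using (∃-syntax; _×_; _,_; proj₁; proj₂)
open import Function using (id; _∘_)
open import Relation.Binary.PropositionalEquality using (_≡_; refl; sym; trans; cong; subst)
open import Relation.Binary.Structures using (IsEquivalence)
open import Relation.Unary using (Pred; _⊆_; _≐_)
open import Relation.Unary.Properties using (≐-refl; ≐-sym; ≐-trans)

>>=-just⁻ : ∀ {a} {A B : Set a} (m : Maybe A) {f : A → Maybe B} {t : B} →
            (m >>= f) ≡ just t → ∃[ v ] (m ≡ just v × f v ≡ just t)
>>=-just⁻ (just v) fv≡t = v , refl , fv≡t
>>=-just⁻ nothing ()

module LiftedProduct {a : Level} (M : PCM a) where
  open PCM M

  private
    _∙_ : Pred Carrier a → Pred Carrier a → Pred Carrier a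
    _∙_ = _•_ M

  •-comm : ∀ X Y → X ∙ Y ⊆ Y ∙ X
  •-comm X Y (x , y , x∈X , y∈Y , xy≡z) = y , x , y∈Y , x∈X , trans (comm y x) xy≡z

  •-mono : ∀ {X X′ Y Y′} → X ⊆ X′ → Y ⊆ Y′ → X ∙ Y ⊆ X′ ∙ Y′
  •-mono X⊆X′ Y⊆Y′ (x , y , x∈X , y∈Y , xy≡z) = x , y , X⊆X′ x∈X , Y⊆Y′ y∈Y , xy≡z

  •-assocʳ : ∀ X Y Z → (X ∙ Y) ∙ Z ⊆ X ∙ (Y ∙ Z)
  •-assocʳ X Y Z (w , z , (x , y , x∈X , y∈Y , xy≡w) , z∈Z , wz≡t)
    with >>=-just⁻ (y · z) (trans (sym (assoc x y z))
                                  (trans (cong (_>>= λ u → u · z) xy≡w) wz≡t))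
  ... | v , yz≡v , xv≡t = x , v , x∈X , (y , z , y∈Y , z∈Z , yz≡v) , xv≡t

  •-assocˡ : ∀ X Y Z → X ∙ (Y ∙ Z) ⊆ (X ∙ Y) ∙ Z
  •-assocˡ X Y Z (x , v , x∈X , (y , z , y∈Y , z∈Z , yz≡v) , xv≡t)
    with >>=-just⁻ (x · y) (trans (assoc x y z)
                                  (trans (cong (_>>= λ u → x · u) yz≡v) xv≡t))
  ... | w , xy≡w , wz≡t = w , z , (x , y , x∈X , y∈Y , xy≡w) , z∈Z , wz≡t

  •-identityˡ : ∀ X → (｛e｝ M ∙ X) ≐ X
  •-identityˡ X = ｛e｝•X⊆X , λ {x} x∈X → e , x , refl , x∈X , identity x
    where
    ｛e｝•X⊆X : ｛e｝ M ∙ X ⊆ X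
    ｛e｝•X⊆X (_ , x , refl , x∈X , ex≡z) =
      subst X (just-injective (trans (sym (identity x)) ex≡z)) x∈X

module StrongClosure {a : Level} (M : PCM a) (C : ClosureOperator M) (strong : IsStrong M C) where
  open PCM M
  open ClosureOperator C
  open LiftedProduct M

  private
    _∙_ : Pred Carrier a → Pred Carrier a → Pred Carrier a
    _∙_ = _•_ M

    _≈_ = _≈𝒞_ M C
    _⊛_ = _*_ M C

  strongʳ : ∀ X Y → X ∙ cl Y ⊆ cl (X ∙ Y)
  strongʳ X Y = monotone (•-comm Y X) ∘ strong Y X ∘ •-comm X (cl Y)

  cl-absorbˡ : ∀ X Y → cl (cl X ∙ Y) ⊆ cl (X ∙ Y)
  cl-absorbˡ X Y = proj₁ (idempotent _) ∘ monotone (strong X Y)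

  cl-absorbʳ : ∀ X Y → cl (X ∙ cl Y) ⊆ cl (X ∙ Y)
  cl-absorbʳ X Y = proj₁ (idempotent _) ∘ monotone (strongʳ X Y)

  ≈-isEquivalence : IsEquivalence _≈_
  ≈-isEquivalence = record { refl = ≐-refl ; sym = ≐-sym ; trans = ≐-trans }

  *-cong : ∀ {X X′ Y Y′} → X ≈ X′ → Y ≈ Y′ → (X ⊛ Y) ≈ (X′ ⊛ Y′)
  *-cong (X⊆X′ , X′⊆X) (Y⊆Y′ , Y′⊆Y) =
    monotone (•-mono X⊆X′ Y⊆Y′) , monotone (•-mono X′⊆X Y′⊆Y)

  *-comm : ∀ X Y → (X ⊛ Y) ≈ (Y ⊛ X)
  *-comm (X , _) (Y , _) = monotone (•-comm X Y) , monotone (•-comm Y X)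

  *-assoc : ∀ X Y Z → ((X ⊛ Y) ⊛ Z) ≈ (X ⊛ (Y ⊛ Z))
  *-assoc (X , _) (Y , _) (Z , _) =
      monotone (•-mono id (extensive _)) ∘ monotone (•-assocʳ X Y Z) ∘ cl-absorbˡ (X ∙ Y) Z
    , monotone (•-mono (extensive _) id) ∘ monotone (•-assocˡ X Y Z) ∘ cl-absorbʳ X (Y ∙ Z)

  *-identityˡ : ∀ X → (emp M C ⊛ X) ≈ X
  *-identityˡ (X , clX⊆X , _) =
      clX⊆X ∘ monotone (proj₁ (•-identityˡ X)) ∘ cl-absorbˡ (｛e｝ M) X
    , extensive _ ∘ •-mono (extensive _) id ∘ proj₂ (•-identityˡ X)

proposition5p7 : {a : Level} (M : PCM a) (C : ClosureOperator M) →
    IsStrong M C →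
    IsCommutativeMonoid (_≈𝒞_ M C) (_*_ M C) (emp M C)
proposition5p7 M C strong = isCommutativeMonoidˡ record
  { isSemigroup = record
    { isMagma = record
      { isEquivalence = ≈-isEquivalence
      ; ∙-cong        = λ {X X′ Y Y′} → *-cong {X} {X′} {Y} {Y′}
      }
    ; assoc = *-assoc
    }
  ; identityˡ = *-identityˡ
  ; comm      = *-comm
  }
  where open StrongClosure M C strong
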